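{- Let $k \in \mathbb{N}$ and let $\mathscr{C}$ be a fixed palette of exactly $7k$ colours. If a finite graph $G$ is inextensible, then this is witnessed by a template $T = (S, c, F)$ on $G$ for which $|F(v)| \le k-1$ for each $v \in V(G) \setminus S$.
   Context: Fix $k \in \mathbb{N}$ and a palette $\mathscr{C}$ with $|\mathscr{C}| = 7k$. A template $T = (S,c,F)$ on a graph $G$ consists of a subset $S \subset V(G)$, a proper colouring $c : S \to \mathscr{C}$ of the induced subgraph $G[S]$, and a function $F : V(G)\setminus S \to 2^{\mathscr{C}}$ (lists of forbidden colours). The degree of $T$ is $\deg(T) = k|S| + \sum_{v \in V(G)\setminus S} |F(v)|$. A proper colouring $\hat c : V(G) \to \mathscr{C}$ of $G$ respects $T$ if $\hat c(v) = c(v)$ for all $v \in S$ and $\hat c(v) \notin F(v)$ for all $v \in V(G)\setminus S$. A graph $G$ is inextensible if there exists a template $T=(S,c,F)$ on $G$ such that (i) $\deg(T) \le 2k^2$, (ii) $|F(v)| \le 2k$ for each $v \in V(G)\setminus S$, and (iii) there is no proper colouring of $G$ with colours from $\mathscr{C}$ that respects $T$; such a $T$ is called a witness for the inextensibility of $G$. -}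

module Defs where

open import Data.Nat using (ℕ; zero; suc; _+_; _*_; _≤_)
open import Data.Fin using (Fin; zero; suc)
open import Data.Fin.Subset using (Subset; _∈_; _∉_; ∣_∣)
open import Data.Vec using ([]; _∷_)
open import Data.Bool using (true; false)
open import Data.Product using (Σ; _×_)
open import Relation.Nullary using (¬_)
open import Relation.Binary.PropositionalEquality using (_≡_; _≢_)

record Graph (n : ℕ) : Set₁ where
  field
    Adj       : Fin n → Fin n → Set
    irrefl    : ∀ {u} → ¬ Adj u u
    sym       : ∀ {u v} → Adj u v → Adj v u

open Graph public

Palette : ℕ → Set
Palette k = Fin (7 * k)

-- A template T = (S, c, F) on G. The colouring c is given as a total
-- function, but only its values on S are used; likewise F is only used off S.
record Template {n : ℕ} (k : ℕ) (G : Graph n) : Set where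
  field
    S      : Subset n
    c      : Fin n → Palette k
    F      : Fin n → Subset (7 * k)
    proper : ∀ u v → u ∈ S → v ∈ S → Adj G u v → c u ≢ c v

open Template public

forbSum : {n m : ℕ} → Subset n → (Fin n → Subset m) → ℕ
forbSum {zero}  []          F = 0
forbSum {suc n} (true  ∷ S) F = forbSum S (λ i → F (suc i))
forbSum {suc n} (false ∷ S) F = ∣ F zero ∣ + forbSum S (λ i → F (suc i))

deg : {n k : ℕ} {G : Graph n} → Template k G → ℕ
deg {k = k} T = k * ∣ S T ∣ + forbSum (S T) (F T)

Respects : {n k : ℕ} {G : Graph n} → Template k G → (Fin n → Palette k) → Set
Respects {G = G} T ĉ =
  (∀ u v → Adj G u v → ĉ u ≢ ĉ v) ×
  (∀ v → v ∈ S T → ĉ v ≡ c T v) ×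
  (∀ v → v ∉ S T → ¬ (ĉ v ∈ F T v))

Witness : {n : ℕ} (k : ℕ) (G : Graph n) → Template k G → Set
Witness k G T =
  (deg T ≤ 2 * (k * k)) ×
  (∀ v → v ∉ S T → ∣ F T v ∣ ≤ 2 * k) ×
  (¬ Σ (Fin _ → Palette k) (λ ĉ → Respects T ĉ))

Inextensible : {n : ℕ} (k : ℕ) (G : Graph n) → Set
Inextensible k G = Σ (Template k G) (Witness k G)

-- If a witness T leaves some v ∉ S with |F(v)| ≥ k (so k ≥ 1), then k|S| ≤ deg T ≤ 2k² gives
-- |S| ≤ 2k, so F(v) together with the colours used on S blocks at most 4k < 7k colours.
-- Precolouring v with an unblocked colour keeps c proper, and any colouring respecting the
-- new template respects T, so none exists; the degree changes by k − |F(v)| ≤ 0. As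
-- Σ_{v∉S} |F(v)| strictly decreases, repeating this ends with every list shorter than k.
module Submission where

open import Defs
open import Data.Nat using (ℕ; _≤_; _∸_)
open import Data.Fin.Subset using (_∉_; ∣_∣)
open import Data.Product using (Σ; _×_)

open import Data.Nat using (zero; suc; _+_; _*_; _<_; s≤s; _≤?_; _<?_; NonZero; >-nonZero⁻¹)
open import Data.Nat.Properties
  using ( ≤-refl; ≤-reflexive; ≤-trans; <-irrefl; ≤-pred; ≰⇒>; n≤1+n; m≤m+n; m<m+n; m<n⇒0<n∸m
        ; +-comm; +-assoc; +-suc; +-mono-≤; +-monoʳ-≤; +-cancelʳ-≤
        ; *-comm; *-assoc; *-distribʳ-+; *-cancelˡ-≤; *-monoˡ-<; module ≤-Reasoning )
open import Data.Nat.Induction using (<-wellFounded)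
open import Data.Nat.Tactic.RingSolver using (solve-∀)
open import Induction.WellFounded using (Acc; acc)
open import Data.Fin using (Fin; zero; suc; _≟_)
open import Data.Fin.Properties using (any?)
open import Data.Fin.Subset using (Subset; _∈_; _∪_; ⁅_⁆; ⊥; ∁; inside; outside)
open import Data.Fin.Subset.Properties
  using (_∈?_; nonempty?; Empty-unique; ∣⊥∣≡0; ∣∁p∣≡n∸∣p∣; x∈∁p⇒x∉p; ∣⁅x⁆∣≡1; x∈⁅x⁆; x∈p∪q⁺)
open import Data.Vec using ([]; _∷_; here; there; _[_]≔_)
open import Data.Vec.Properties using ([]≔-updates; []≔-minimal; lookup∘update′; []=⇒lookup; lookup⇒[]=)
open import Data.Vec.Functional using (updateAt)
open import Data.Vec.Functional.Properties using (updateAt-updates; updateAt-minimal)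
open import Data.Product using (_,_; ∃; proj₁; proj₂)
open import Data.Sum using (inj₁; inj₂)
open import Function using (_∘_; const)
open import Relation.Nullary using (¬_; yes; no; ¬?; contradiction)
open import Relation.Nullary.Decidable using (_×-dec_; from-yes)
open import Relation.Binary.PropositionalEquality as ≡ using (_≡_; _≢_; refl; cong; subst; subst₂; ≢-sym)

∣p∪q∣≤∣p∣+∣q∣ : ∀ {n} (p q : Subset n) → ∣ p ∪ q ∣ ≤ ∣ p ∣ + ∣ q ∣
∣p∪q∣≤∣p∣+∣q∣ []            []            = ≤-refl
∣p∪q∣≤∣p∣+∣q∣ (inside  ∷ p) (outside ∷ q) = s≤s (∣p∪q∣≤∣p∣+∣q∣ p q)
∣p∪q∣≤∣p∣+∣q∣ (inside  ∷ p) (inside  ∷ q) =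
  s≤s (≤-trans (∣p∪q∣≤∣p∣+∣q∣ p q) (+-monoʳ-≤ ∣ p ∣ (n≤1+n ∣ q ∣)))
∣p∪q∣≤∣p∣+∣q∣ (outside ∷ p) (outside ∷ q) = ∣p∪q∣≤∣p∣+∣q∣ p q
∣p∪q∣≤∣p∣+∣q∣ (outside ∷ p) (inside  ∷ q) =
  ≤-trans (s≤s (∣p∪q∣≤∣p∣+∣q∣ p q)) (≤-reflexive (≡.sym (+-suc ∣ p ∣ ∣ q ∣)))

∣p∣<n⇒∃x∉p : ∀ {n} (p : Subset n) → ∣ p ∣ < n → ∃ λ x → x ∉ p
∣p∣<n⇒∃x∉p {n} p ∣p∣<n with nonempty? (∁ p)
... | yes (x , x∈∁p) = x , x∈∁p⇒x∉p x∈∁p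
... | no ∁p-empty = contradiction 0<0 (<-irrefl refl)
  where
  open ≤-Reasoning
  0<0 : 0 < 0
  0<0 = begin-strict
    0              <⟨ m<n⇒0<n∸m ∣p∣<n ⟩
    n ∸ ∣ p ∣      ≡⟨ ∣∁p∣≡n∸∣p∣ p ⟨
    ∣ ∁ p ∣        ≡⟨ cong ∣_∣ (Empty-unique ∁p-empty) ⟩
    ∣ ⊥ {n = n} ∣  ≡⟨ ∣⊥∣≡0 n ⟩
    0              ∎

image : ∀ {n m} → (Fin n → Fin m) → Subset n → Subset m
image f []            = ⊥
image f (inside  ∷ p) = ⁅ f zero ⁆ ∪ image (f ∘ suc) p
image f (outside ∷ p) = image (f ∘ suc) p

∣image∣≤∣p∣ : ∀ {n m} (f : Fin n → Fin m) (p : Subset n) → ∣ image f p ∣ ≤ ∣ p ∣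
∣image∣≤∣p∣ {m = m} f []   = ≤-reflexive (∣⊥∣≡0 m)
∣image∣≤∣p∣ f (inside  ∷ p) = begin
  ∣ ⁅ f zero ⁆ ∪ image (f ∘ suc) p ∣      ≤⟨ ∣p∪q∣≤∣p∣+∣q∣ ⁅ f zero ⁆ _ ⟩
  ∣ ⁅ f zero ⁆ ∣ + ∣ image (f ∘ suc) p ∣  ≡⟨ cong (_+ ∣ image (f ∘ suc) p ∣) (∣⁅x⁆∣≡1 (f zero)) ⟩
  suc ∣ image (f ∘ suc) p ∣               ≤⟨ s≤s (∣image∣≤∣p∣ (f ∘ suc) p) ⟩
  suc ∣ p ∣                               ∎
  where open ≤-Reasoning
∣image∣≤∣p∣ f (outside ∷ p) = ∣image∣≤∣p∣ (f ∘ suc) p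

image⁺ : ∀ {n m} (f : Fin n → Fin m) {p : Subset n} {x} → x ∈ p → f x ∈ image f p
image⁺ f {inside  ∷ p} here        = x∈p∪q⁺ (inj₁ (x∈⁅x⁆ (f zero)))
image⁺ f {inside  ∷ p} (there x∈p) = x∈p∪q⁺ (inj₂ (image⁺ (f ∘ suc) x∈p))
image⁺ f {outside ∷ p} (there x∈p) = image⁺ (f ∘ suc) x∈p

∣p[x]≔inside∣≡1+∣p∣ : ∀ {n} (p : Subset n) {x} → x ∉ p → ∣ p [ x ]≔ inside ∣ ≡ suc ∣ p ∣
∣p[x]≔inside∣≡1+∣p∣ (inside  ∷ p) {zero}  x∉p = contradiction here x∉p
∣p[x]≔inside∣≡1+∣p∣ (outside ∷ p) {zero}  x∉p = refl
∣p[x]≔inside∣≡1+∣p∣ (inside  ∷ p) {suc x} x∉p = cong suc (∣p[x]≔inside∣≡1+∣p∣ p (x∉p ∘ there))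
∣p[x]≔inside∣≡1+∣p∣ (outside ∷ p) {suc x} x∉p = ∣p[x]≔inside∣≡1+∣p∣ p (x∉p ∘ there)

∈-[]≔⁺ : ∀ {n} (p : Subset n) {x y} → y ∈ p → y ∈ p [ x ]≔ inside
∈-[]≔⁺ p {x} {y} y∈p with y ≟ x
... | yes refl = []≔-updates p x
... | no  y≢x  = []≔-minimal p y x y≢x y∈p

∈-[]≔⁻ : ∀ {n} (p : Subset n) {x y} b → y ≢ x → y ∈ p [ x ]≔ b → y ∈ p
∈-[]≔⁻ p {x} {y} b y≢x y∈ =
  lookup⇒[]= y p (≡.trans (≡.sym (lookup∘update′ y≢x p b)) ([]=⇒lookup y∈))

forbSum-[]≔inside : ∀ {n m} (p : Subset n) (F : Fin n → Subset m) {x} → x ∉ p →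
  forbSum (p [ x ]≔ inside) F + ∣ F x ∣ ≡ forbSum p F
forbSum-[]≔inside (inside  ∷ p) F {zero}  x∉p = contradiction here x∉p
forbSum-[]≔inside (outside ∷ p) F {zero}  x∉p = +-comm (forbSum p (F ∘ suc)) ∣ F zero ∣
forbSum-[]≔inside (inside  ∷ p) F {suc x} x∉p = forbSum-[]≔inside p (F ∘ suc) (x∉p ∘ there)
forbSum-[]≔inside (outside ∷ p) F {suc x} x∉p =
  ≡.trans (+-assoc ∣ F zero ∣ _ _)
          (cong (∣ F zero ∣ +_) (forbSum-[]≔inside p (F ∘ suc) (x∉p ∘ there)))

module _ {n k : ℕ} {G : Graph n} where

  precolour : (T : Template k G) (v : Fin n) (α : Palette k) →
              (∀ u → u ∈ S T → Adj G u v → c T u ≢ α) → Template k G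
  precolour T v α fresh = record
    { S = S T [ v ]≔ inside ; c = updateAt (c T) v (const α) ; F = F T ; proper = proper′ }
    where
    recoloured-v : updateAt (c T) v (const α) v ≡ α
    recoloured-v = updateAt-updates v (c T)

    unchanged : ∀ {u} → u ≢ v → updateAt (c T) v (const α) u ≡ c T u
    unchanged {u} u≢v = updateAt-minimal u v (c T) u≢v

    proper′ : ∀ u w → u ∈ S T [ v ]≔ inside → w ∈ S T [ v ]≔ inside → Adj G u w →
              updateAt (c T) v (const α) u ≢ updateAt (c T) v (const α) w
    proper′ u w u∈ w∈ adj with u ≟ v | w ≟ v
    ... | yes refl | yes refl = contradiction adj (irrefl G)
    ... | yes refl | no  w≢v  = subst₂ _≢_ (≡.sym recoloured-v) (≡.sym (unchanged w≢v))
                                  (≢-sym (fresh w (∈-[]≔⁻ (S T) inside w≢v w∈) (sym G adj)))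
    ... | no  u≢v  | yes refl = subst₂ _≢_ (≡.sym (unchanged u≢v)) (≡.sym recoloured-v)
                                  (fresh u (∈-[]≔⁻ (S T) inside u≢v u∈) adj)
    ... | no  u≢v  | no  w≢v  = subst₂ _≢_ (≡.sym (unchanged u≢v)) (≡.sym (unchanged w≢v))
                                  (proper T u w (∈-[]≔⁻ (S T) inside u≢v u∈)
                                                (∈-[]≔⁻ (S T) inside w≢v w∈) adj)

  module _ (T : Template k G) {v : Fin n} {α : Palette k}
           (fresh : ∀ u → u ∈ S T → Adj G u v → c T u ≢ α) (v∉S : v ∉ S T) where

    precolour-respects : α ∉ F T v → ∀ {ĉ} → Respects (precolour T v α fresh) ĉ → Respects T ĉ
    precolour-respects α∉Fv {ĉ} (proper-ĉ , onS , offS) = proper-ĉ , onS′ , offS′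
      where
      onS′ : ∀ u → u ∈ S T → ĉ u ≡ c T u
      onS′ u u∈S = ≡.trans (onS u (∈-[]≔⁺ (S T) u∈S))
                           (updateAt-minimal u v (c T) λ { refl → v∉S u∈S })

      offS′ : ∀ u → u ∉ S T → ¬ ĉ u ∈ F T u
      offS′ u u∉S with u ≟ v
      ... | yes refl = α∉Fv ∘ subst (_∈ F T v)
                         (≡.trans (onS v ([]≔-updates (S T) v)) (updateAt-updates v (c T)))
      ... | no  u≢v  = offS u (u∉S ∘ ∈-[]≔⁻ (S T) inside u≢v)

    deg-precolour : deg (precolour T v α fresh) + ∣ F T v ∣ ≡ deg T + k
    deg-precolour = begin
      k * ∣ S′ ∣ + rest + ∣ F T v ∣
        ≡⟨ cong (λ s → k * s + rest + ∣ F T v ∣) (∣p[x]≔inside∣≡1+∣p∣ (S T) v∉S) ⟩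
      k * suc ∣ S T ∣ + rest + ∣ F T v ∣
        ≡⟨ rearrange k ∣ S T ∣ rest (∣ F T v ∣) ⟩
      k * ∣ S T ∣ + (rest + ∣ F T v ∣) + k
        ≡⟨ cong (λ f → k * ∣ S T ∣ + f + k) (forbSum-[]≔inside (S T) (F T) v∉S) ⟩
      deg T + k
        ∎
      where
      open ≡.≡-Reasoning
      S′ : Subset n
      S′ = S T [ v ]≔ inside
      rest : ℕ
      rest = forbSum S′ (F T)
      rearrange : ∀ k s a b → k * suc s + a + b ≡ k * s + (a + b) + k
      rearrange = solve-∀

    precolour-witness : α ∉ F T v → k ≤ ∣ F T v ∣ →
                        Witness k G T → Witness k G (precolour T v α fresh)
    precolour-witness α∉Fv k≤∣Fv∣ (deg≤ , F≤ , ¬respected) = deg′≤ , F′≤ , ¬respected′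
      where
      deg′≤ : deg (precolour T v α fresh) ≤ 2 * (k * k)
      deg′≤ = ≤-trans (+-cancelʳ-≤ ∣ F T v ∣ _ _ (begin
        deg (precolour T v α fresh) + ∣ F T v ∣  ≡⟨ deg-precolour ⟩
        deg T + k                                ≤⟨ +-monoʳ-≤ (deg T) k≤∣Fv∣ ⟩
        deg T + ∣ F T v ∣                        ∎)) deg≤
        where open ≤-Reasoning

      F′≤ : ∀ u → u ∉ S T [ v ]≔ inside → ∣ F T u ∣ ≤ 2 * k
      F′≤ u u∉S′ = F≤ u (u∉S′ ∘ ∈-[]≔⁺ (S T))

      ¬respected′ : ¬ Σ (Fin n → Palette k) (Respects (precolour T v α fresh))
      ¬respected′ (ĉ , respects) = ¬respected (ĉ , precolour-respects α∉Fv respects)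

  ∣S∣≤2k : .{{_ : NonZero k}} (T : Template k G) → deg T ≤ 2 * (k * k) → ∣ S T ∣ ≤ 2 * k
  ∣S∣≤2k T deg≤ = *-cancelˡ-≤ k (begin
    k * ∣ S T ∣   ≤⟨ m≤m+n (k * ∣ S T ∣) _ ⟩
    deg T         ≤⟨ deg≤ ⟩
    2 * (k * k)   ≡⟨ *-assoc 2 k k ⟨
    2 * k * k     ≡⟨ *-comm (2 * k) k ⟩
    k * (2 * k)   ∎)
    where open ≤-Reasoning

  freshColour : .{{_ : NonZero k}} (T : Template k G) → Witness k G T → ∀ v → v ∉ S T →
                ∃ λ α → α ∉ F T v × (∀ u → u ∈ S T → c T u ≢ α)
  freshColour T (deg≤ , F≤ , _) v v∉S =
    α , α∉blocked ∘ x∈p∪q⁺ ∘ inj₁ ,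
    λ u u∈S cu≡α → α∉blocked (x∈p∪q⁺ (inj₂ (subst (_∈ _) cu≡α (image⁺ (c T) u∈S))))
    where
    blocked : Subset (7 * k)
    blocked = F T v ∪ image (c T) (S T)

    ∣blocked∣<7k : ∣ blocked ∣ < 7 * k
    ∣blocked∣<7k = begin-strict
      ∣ blocked ∣                           ≤⟨ ∣p∪q∣≤∣p∣+∣q∣ (F T v) _ ⟩
      ∣ F T v ∣ + ∣ image (c T) (S T) ∣     ≤⟨ +-monoʳ-≤ ∣ F T v ∣ (∣image∣≤∣p∣ (c T) (S T)) ⟩
      ∣ F T v ∣ + ∣ S T ∣                   ≤⟨ +-mono-≤ (F≤ v v∉S) (∣S∣≤2k T deg≤) ⟩
      2 * k + 2 * k                         ≡⟨ *-distribʳ-+ k 2 2 ⟨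
      4 * k                                 <⟨ *-monoˡ-< k (from-yes (4 <? 7)) ⟩
      7 * k                                 ∎
      where open ≤-Reasoning

    α : Palette k
    α = proj₁ (∣p∣<n⇒∃x∉p blocked ∣blocked∣<7k)
    α∉blocked : α ∉ blocked
    α∉blocked = proj₂ (∣p∣<n⇒∃x∉p blocked ∣blocked∣<7k)

  ShortLists : Template k G → Set
  ShortLists T = ∀ v → v ∉ S T → ∣ F T v ∣ < k

  shortenLists : .{{_ : NonZero k}} (T : Template k G) → Witness k G T →
                 Acc _<_ (forbSum (S T) (F T)) → Σ (Template k G) λ T′ → Witness k G T′ × ShortLists T′
  shortenLists T witness (acc smaller)
    with any? (λ v → ¬? (v ∈? S T) ×-dec (k ≤? ∣ F T v ∣))
  ... | no ∄long = T , witness , λ v v∉S → ≰⇒> (∄long ∘ (v ,_) ∘ (v∉S ,_))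
  ... | yes (v , v∉S , k≤∣Fv∣) =
    shortenLists T′ (precolour-witness T fresh v∉S α∉Fv k≤∣Fv∣ witness) (smaller forbSum-decreases)
    where
    chosen : ∃ λ α → α ∉ F T v × (∀ u → u ∈ S T → c T u ≢ α)
    chosen = freshColour T witness v v∉S
    α : Palette k
    α = proj₁ chosen
    α∉Fv : α ∉ F T v
    α∉Fv = proj₁ (proj₂ chosen)
    fresh : ∀ u → u ∈ S T → Adj G u v → c T u ≢ α
    fresh u u∈S _ = proj₂ (proj₂ chosen) u u∈S
    T′ : Template k G
    T′ = precolour T v α fresh

    forbSum-decreases : forbSum (S T′) (F T′) < forbSum (S T) (F T)
    forbSum-decreases = ≤-trans (m<m+n _ (≤-trans (>-nonZero⁻¹ k) k≤∣Fv∣))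
                                (≤-reflexive (forbSum-[]≔inside (S T) (F T) v∉S))

lemma2p2 : (k n : ℕ) (G : Graph n) → Inextensible k G →
    Σ (Template k G) (λ T → Witness k G T × (∀ v → v ∉ S T → ∣ F T v ∣ ≤ k ∸ 1))
lemma2p2 zero    n G (T , witness@(_ , F≤0 , _)) = T , witness , F≤0
lemma2p2 (suc _) n G (T , witness) with shortenLists T witness (<-wellFounded _)
... | T′ , witness′ , short = T′ , witness′ , λ v v∉S → ≤-pred (short v v∉S)
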